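{- For any two permutations $\pi,\sigma$ on $[n]$, $$\sum_{(x,y)\in S(\pi,\sigma)}\big(\pi^{ -1}(y)-\pi^{ -1}(x)\big)=\frac12\|v_\pi-v_\sigma\|^2.$$
   Context: For a permutation $\pi$ on $[n]$, $\pi^{ -1}(i)$ is the position of element $i$ and $v_\pi=(\pi^{ -1}(1),\dots,\pi^{ -1}(n))\in\mathbb R^n$; $\|\cdot\|$ is the Euclidean norm. $S(\pi,\sigma)$ is the set of ordered pairs $(x,y)$ of elements such that $x$ occurs before $y$ in $\pi$ and $y$ occurs before $x$ in $\sigma$. -}

module Defs where

open import Data.Nat using (ℕ; suc)
open import Data.Fin using (Fin; toℕ; _<?_)
open import Data.Fin.Permutation using (Permutation′; _⟨$⟩ʳ_; _⟨$⟩ˡ_)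
open import Data.Integer using (ℤ; +_; _-_; _*_; _+_; 0ℤ)
open import Data.List using (List; allFin; concatMap; filter; map; foldr)
import Data.Integer as ℤ
open import Data.Product using (_×_; _,_; proj₁; proj₂)
open import Relation.Nullary using (_×-dec_)

-- A permutation π on [n] is a bijection Fin n ↔ Fin n, read as
-- position ↦ element (π(i) is the element at position i).
-- Elements and positions are 0-indexed (Fin n); only differences of
-- positions enter the statement, so the shift is immaterial.

pos : ∀ {n} → Permutation′ n → Fin n → ℤ
pos π x = + toℕ (π ⟨$⟩ˡ x)

sumℤ : List ℤ → ℤ
sumℤ = foldr _+_ 0ℤ

allPairs : ∀ n → List (Fin n × Fin n)
allPairs n = concatMap (λ x → map (λ y → (x , y)) (allFin n)) (allFin n)

S : ∀ {n} → Permutation′ n → Permutation′ n → List (Fin n × Fin n)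
S π σ = filter
  (λ p → ((π ⟨$⟩ˡ proj₁ p) <? (π ⟨$⟩ˡ proj₂ p))
         ×-dec ((σ ⟨$⟩ˡ proj₂ p) <? (σ ⟨$⟩ˡ proj₁ p)))
  (allPairs _)

-- v_π = (π⁻¹(1), …, π⁻¹(n)); squared Euclidean distance ‖v_π − v_σ‖²
sqDist : ∀ {n} → Permutation′ n → Permutation′ n → ℤ
sqDist {n} π σ = sumℤ (map (λ i → (pos π i - pos σ i) * (pos π i - pos σ i)) (allFin n))

lhsSum : ∀ {n} → Permutation′ n → Permutation′ n → ℤ
lhsSum π σ = sumℤ (map (λ p → pos π (proj₂ p) - pos π (proj₁ p)) (S π σ))

{-# OPTIONS --safe #-}
module Submission where

-- Write P x = π⁻¹(x) and Q x = σ⁻¹(x), and 𝟙S x y for the indicator of (x , y) ∈ S(π,σ).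
-- Counting the elements before x in π and in σ gives
--   P x − Q x = Σ_y (𝟙S y x − 𝟙S x y),
-- the net number of pairs of S ending rather than starting at x. Reindexing the double
-- sum therefore turns Σ_{(x,y)∈S} (P y − P x) into Σ_x P x (P x − Q x), and
--   2 Σ_x P x (P x − Q x) = Σ_x (P x − Q x)² + Σ_x P x² − Σ_x Q x²,
-- where the last two sums agree since both are 0² + 1² + ⋯ + (n−1)².

open import Defs
open import Data.Nat using (ℕ; zero; suc)
open import Data.Bool using (if_then_else_)
open import Data.Empty using (⊥-elim)
open import Data.Fin using (Fin; zero; suc; toℕ; _<_; _<?_; _≟_)
open import Data.Fin.Properties using (<-cmp; <-irrefl)
open import Data.Fin.Permutation using (Permutation′; _⟨$⟩ˡ_; flip)
open import Data.Integer using (ℤ; +_; _*_; _+_; _-_; -_; 0ℤ; 1ℤ)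
import Data.Integer.Properties as ℤP
open import Data.Integer.Tactic.RingSolver using (solve-∀)
open import Data.List using (List; []; _∷_; map; filter; allFin; tabulate; concatMap; _++_)
open import Data.List.Properties using (map-tabulate; map-∘)
open import Data.Product using (_×_; _,_; proj₁; proj₂)
open import Function using (_∘_; id)
open import Function.Bundles using (Injection)
open import Function.Properties.Inverse using (↔⇒↣)
open import Relation.Binary.Definitions using (tri<; tri≈; tri>)
open import Relation.Nullary using (Dec; yes; no; does; ¬_; _×-dec_)
open import Relation.Unary using (Decidable)
open import Relation.Binary.PropositionalEquality
open import Algebra.Properties.Semiring.Sum ℤP.+-*-semiring
  using (sum; sum-syntax; sum-cong-≗; ∑-distrib-+; ∑-comm; ∑-permute; *-distribˡ-sum)

open ≡-Reasoning

∑-zero : ∀ n → ∑[ i < n ] 0ℤ ≡ 0ℤ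
∑-zero zero    = refl
∑-zero (suc n) = trans (ℤP.+-identityˡ _) (∑-zero n)

∑-neg : ∀ {n} (f : Fin n → ℤ) → ∑[ i < n ] (- f i) ≡ - sum f
∑-neg f = begin
  sum (λ i → - f i)         ≡⟨ sum-cong-≗ (λ i → ℤP.-1*i≡-i (f i)) ⟨
  sum (λ i → - 1ℤ * f i)    ≡⟨ *-distribˡ-sum (- 1ℤ) f ⟨
  - 1ℤ * sum f              ≡⟨ ℤP.-1*i≡-i (sum f) ⟩
  - sum f                   ∎

∑-distrib-- : ∀ {n} (f g : Fin n → ℤ) → ∑[ i < n ] (f i - g i) ≡ sum f - sum g
∑-distrib-- f g = trans (∑-distrib-+ f (λ i → - g i)) (cong (_+_ (sum f)) (∑-neg g))

∑∑-distrib-- : ∀ {n} (f g : Fin n → Fin n → ℤ) →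
  ∑[ x < n ] ∑[ y < n ] (f x y - g x y) ≡ ∑[ x < n ] ∑[ y < n ] f x y - ∑[ x < n ] ∑[ y < n ] g x y
∑∑-distrib-- f g =
  trans (sum-cong-≗ (λ x → ∑-distrib-- (f x) (g x))) (∑-distrib-- (sum ∘ f) (sum ∘ g))

∑-permuteˡ : ∀ {n} (f : Fin n → ℤ) (π : Permutation′ n) → ∑[ i < n ] f (π ⟨$⟩ˡ i) ≡ sum f
∑-permuteˡ f π = sym (∑-permute f (flip π))

-- Summation by parts: T x y is read as a flow from x to y and g as a potential.
∑-flow : ∀ {n} (T : Fin n → Fin n → ℤ) (g : Fin n → ℤ) →
  ∑[ x < n ] ∑[ y < n ] (T x y * (g y - g x)) ≡ ∑[ x < n ] (g x * ∑[ y < n ] (T y x - T x y))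
∑-flow {n} T g = begin
  ∑[ x < n ] ∑[ y < n ] (T x y * (g y - g x))
    ≡⟨ sum-cong-≗ (λ x → sum-cong-≗ (λ y → distrib (T x y) (g y) (g x))) ⟩
  ∑[ x < n ] ∑[ y < n ] (T x y * g y - T x y * g x)
    ≡⟨ ∑∑-distrib-- (λ x y → T x y * g y) (λ x y → T x y * g x) ⟩
  ∑[ x < n ] ∑[ y < n ] (T x y * g y) - ∑[ x < n ] ∑[ y < n ] (T x y * g x)
    ≡⟨ cong (_- ∑[ x < n ] ∑[ y < n ] (T x y * g x)) (∑-comm (λ x y → T x y * g y)) ⟩
  ∑[ x < n ] ∑[ y < n ] (T y x * g x) - ∑[ x < n ] ∑[ y < n ] (T x y * g x)
    ≡⟨ ∑∑-distrib-- (λ x y → T y x * g x) (λ x y → T x y * g x) ⟨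
  ∑[ x < n ] ∑[ y < n ] (T y x * g x - T x y * g x)
    ≡⟨ sum-cong-≗ (λ x → sum-cong-≗ (λ y → factor (T y x) (T x y) (g x))) ⟩
  ∑[ x < n ] ∑[ y < n ] (g x * (T y x - T x y))
    ≡⟨ sum-cong-≗ (λ x → *-distribˡ-sum (g x) (λ y → T y x - T x y)) ⟨
  ∑[ x < n ] (g x * ∑[ y < n ] (T y x - T x y)) ∎
  where
  distrib : ∀ t a b → t * (a - b) ≡ t * a - t * b
  distrib = solve-∀
  factor : ∀ s t a → s * a - t * a ≡ a * (s - t)
  factor = solve-∀

∑-polarization : ∀ {n} (g h : Fin n → ℤ) → ∑[ i < n ] (g i * g i) ≡ ∑[ i < n ] (h i * h i) →
  + 2 * ∑[ i < n ] (g i * (g i - h i)) ≡ ∑[ i < n ] ((g i - h i) * (g i - h i))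
∑-polarization {n} g h ∑g²≡∑h² = begin
  + 2 * ∑[ i < n ] (g i * (g i - h i))
    ≡⟨ *-distribˡ-sum (+ 2) (λ i → g i * (g i - h i)) ⟩
  sum twice-cross
    ≡⟨ ℤP.+-identityʳ (sum twice-cross) ⟨
  sum twice-cross + 0ℤ
    ≡⟨ cong (_+_ (sum twice-cross)) (ℤP.+-inverseʳ (sum g²)) ⟨
  sum twice-cross + (sum g² - sum g²)
    ≡⟨ cong (λ s → sum twice-cross + (s - sum g²)) ∑g²≡∑h² ⟩
  sum twice-cross + (sum h² - sum g²)
    ≡⟨ cong (_+_ (sum twice-cross)) (∑-distrib-- h² g²) ⟨
  sum twice-cross + ∑[ i < n ] (h² i - g² i)
    ≡⟨ ∑-distrib-+ twice-cross (λ i → h² i - g² i) ⟨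
  ∑[ i < n ] (twice-cross i + (h² i - g² i))
    ≡⟨ sum-cong-≗ (λ i → square (g i) (h i)) ⟩
  ∑[ i < n ] ((g i - h i) * (g i - h i)) ∎
  where
  g² h² twice-cross : Fin n → ℤ
  g² i = g i * g i
  h² i = h i * h i
  twice-cross i = + 2 * (g i * (g i - h i))
  square : ∀ a b → + 2 * (a * (a - b)) + (b * b - a * a) ≡ (a - b) * (a - b)
  square = solve-∀

𝟙 : ∀ {p} {P : Set p} → Dec P → ℤ
𝟙 d = if does d then 1ℤ else 0ℤ

𝟙-yes : ∀ {p} {P : Set p} (d : Dec P) → P → 𝟙 d ≡ 1ℤ
𝟙-yes (yes _) _  = refl
𝟙-yes (no ¬p) p = ⊥-elim (¬p p)

𝟙-no : ∀ {p} {P : Set p} (d : Dec P) → ¬ P → 𝟙 d ≡ 0ℤ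
𝟙-no (yes p) ¬p = ⊥-elim (¬p p)
𝟙-no (no _)  _  = refl

𝟙-×-dec : ∀ {p q} {P : Set p} {Q : Set q} (a : Dec P) (b : Dec Q) → 𝟙 (a ×-dec b) ≡ 𝟙 a * 𝟙 b
𝟙-×-dec (yes _) b = sym (ℤP.*-identityˡ (𝟙 b))
𝟙-×-dec (no _)  b = refl

𝟙-<-irrefl : ∀ {n} (a : Fin n) → 𝟙 (a <? a) ≡ 0ℤ
𝟙-<-irrefl a = 𝟙-no (a <? a) (<-irrefl refl)

𝟙-<-flip : ∀ {n} {a b : Fin n} → a ≢ b → 𝟙 (b <? a) ≡ 1ℤ - 𝟙 (a <? b)
𝟙-<-flip {a = a} {b} a≢b with <-cmp a b
... | tri< a<b _ b≮a rewrite 𝟙-yes (a <? b) a<b | 𝟙-no (b <? a) b≮a = refl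
... | tri≈ _ a≡b _   = ⊥-elim (a≢b a≡b)
... | tri> a≮b _ b<a rewrite 𝟙-no (a <? b) a≮b | 𝟙-yes (b <? a) b<a = refl

∑-𝟙-< : ∀ {n} (k : Fin n) → ∑[ j < n ] 𝟙 (j <? k) ≡ + toℕ k
∑-𝟙-< {suc n} zero    = ∑-zero (suc n)   -- j <? zero computes to no
∑-𝟙-< {suc n} (suc k) = cong (_+_ 1ℤ) (∑-𝟙-< k)

⟨$⟩ˡ-injective : ∀ {n} (π : Permutation′ n) {x y} → π ⟨$⟩ˡ x ≡ π ⟨$⟩ˡ y → x ≡ y
⟨$⟩ˡ-injective π = Injection.injective (↔⇒↣ (flip π))

pos≡∑-before : ∀ {n} (π : Permutation′ n) (x : Fin n) →
  pos π x ≡ ∑[ y < n ] 𝟙 (π ⟨$⟩ˡ y <? π ⟨$⟩ˡ x)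
pos≡∑-before π x = trans (sym (∑-𝟙-< (π ⟨$⟩ˡ x))) (sym (∑-permuteˡ _ π))

𝟙S : ∀ {n} → Permutation′ n → Permutation′ n → Fin n → Fin n → ℤ
𝟙S π σ x y = 𝟙 (π ⟨$⟩ˡ x <? π ⟨$⟩ˡ y) * 𝟙 (σ ⟨$⟩ˡ y <? σ ⟨$⟩ˡ x)

𝟙-before-sub : ∀ {n} (π σ : Permutation′ n) (x y : Fin n) →
  𝟙 (π ⟨$⟩ˡ y <? π ⟨$⟩ˡ x) - 𝟙 (σ ⟨$⟩ˡ y <? σ ⟨$⟩ˡ x) ≡ 𝟙S π σ y x - 𝟙S π σ x y
𝟙-before-sub π σ x y with x ≟ y
... | yes refl rewrite 𝟙-<-irrefl (π ⟨$⟩ˡ x) | 𝟙-<-irrefl (σ ⟨$⟩ˡ x) = refl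
... | no x≢y = begin
  a - b                              ≡⟨ complement a b ⟩
  a * (1ℤ - b) - (1ℤ - a) * b        ≡⟨ cong₂ (λ u v → a * v - u * b)
                                          (𝟙-<-flip (x≢y ∘ sym ∘ ⟨$⟩ˡ-injective π))
                                          (𝟙-<-flip (x≢y ∘ sym ∘ ⟨$⟩ˡ-injective σ)) ⟨
  𝟙S π σ y x - 𝟙S π σ x y            ∎
  where
  a = 𝟙 (π ⟨$⟩ˡ y <? π ⟨$⟩ˡ x)
  b = 𝟙 (σ ⟨$⟩ˡ y <? σ ⟨$⟩ˡ x)
  complement : ∀ a b → a - b ≡ a * (1ℤ - b) - (1ℤ - a) * b
  complement = solve-∀

pos-sub≡∑𝟙S : ∀ {n} (π σ : Permutation′ n) (x : Fin n) →
  pos π x - pos σ x ≡ ∑[ y < n ] (𝟙S π σ y x - 𝟙S π σ x y)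
pos-sub≡∑𝟙S π σ x = begin
  pos π x - pos σ x
    ≡⟨ cong₂ _-_ (pos≡∑-before π x) (pos≡∑-before σ x) ⟩
  sum (λ y → 𝟙 (π ⟨$⟩ˡ y <? π ⟨$⟩ˡ x)) - sum (λ y → 𝟙 (σ ⟨$⟩ˡ y <? σ ⟨$⟩ˡ x))
    ≡⟨ ∑-distrib-- (λ y → 𝟙 (π ⟨$⟩ˡ y <? π ⟨$⟩ˡ x)) (λ y → 𝟙 (σ ⟨$⟩ˡ y <? σ ⟨$⟩ˡ x)) ⟨
  sum (λ y → 𝟙 (π ⟨$⟩ˡ y <? π ⟨$⟩ˡ x) - 𝟙 (σ ⟨$⟩ˡ y <? σ ⟨$⟩ˡ x))
    ≡⟨ sum-cong-≗ (𝟙-before-sub π σ x) ⟩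
  sum (λ y → 𝟙S π σ y x - 𝟙S π σ x y) ∎

sumℤ-map-++ : ∀ {A : Set} (f : A → ℤ) (xs ys : List A) →
  sumℤ (map f (xs ++ ys)) ≡ sumℤ (map f xs) + sumℤ (map f ys)
sumℤ-map-++ f []       ys = sym (ℤP.+-identityˡ _)
sumℤ-map-++ f (x ∷ xs) ys = trans (cong (_+_ (f x)) (sumℤ-map-++ f xs ys)) (sym (ℤP.+-assoc (f x) _ _))

sumℤ-map-concatMap : ∀ {A B : Set} (f : B → ℤ) (g : A → List B) (xs : List A) →
  sumℤ (map f (concatMap g xs)) ≡ sumℤ (map (λ x → sumℤ (map f (g x))) xs)
sumℤ-map-concatMap f g []       = refl
sumℤ-map-concatMap f g (x ∷ xs) =
  trans (sumℤ-map-++ f (g x) (concatMap g xs)) (cong (_+_ (sumℤ (map f (g x)))) (sumℤ-map-concatMap f g xs))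

sumℤ-map-filter : ∀ {A : Set} {P : A → Set} (P? : Decidable P) (f : A → ℤ) (xs : List A) →
  sumℤ (map f (filter P? xs)) ≡ sumℤ (map (λ x → 𝟙 (P? x) * f x) xs)
sumℤ-map-filter P? f [] = refl
sumℤ-map-filter P? f (x ∷ xs) with P? x
... | yes _ = cong₂ _+_ (sym (ℤP.*-identityˡ (f x))) (sumℤ-map-filter P? f xs)
... | no _  = trans (sumℤ-map-filter P? f xs) (sym (ℤP.+-identityˡ _))

sumℤ-tabulate : ∀ {n} (f : Fin n → ℤ) → sumℤ (tabulate f) ≡ sum f
sumℤ-tabulate {zero}  f = refl
sumℤ-tabulate {suc n} f = cong (_+_ (f zero)) (sumℤ-tabulate (f ∘ suc))

sumℤ-map-allFin : ∀ {n} (f : Fin n → ℤ) → sumℤ (map f (allFin n)) ≡ sum f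
sumℤ-map-allFin f = trans (cong sumℤ (map-tabulate id f)) (sumℤ-tabulate f)

sumℤ-map-allPairs : ∀ {n} (f : Fin n × Fin n → ℤ) →
  sumℤ (map f (allPairs n)) ≡ ∑[ x < n ] ∑[ y < n ] f (x , y)
sumℤ-map-allPairs {n} f = begin
  sumℤ (map f (allPairs n))
    ≡⟨ sumℤ-map-concatMap f _ (allFin n) ⟩
  sumℤ (map (λ x → sumℤ (map f (map (x ,_) (allFin n)))) (allFin n))
    ≡⟨ sumℤ-map-allFin (λ x → sumℤ (map f (map (x ,_) (allFin n)))) ⟩
  ∑[ x < n ] sumℤ (map f (map (x ,_) (allFin n)))
    ≡⟨ sum-cong-≗ (λ x → trans (cong sumℤ (sym (map-∘ (allFin n)))) (sumℤ-map-allFin (λ y → f (x , y)))) ⟩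
  ∑[ x < n ] ∑[ y < n ] f (x , y) ∎

lhsSum≡∑𝟙S : ∀ {n} (π σ : Permutation′ n) →
  lhsSum π σ ≡ ∑[ x < n ] ∑[ y < n ] (𝟙S π σ x y * (pos π y - pos π x))
lhsSum≡∑𝟙S {n} π σ = begin
  lhsSum π σ
    ≡⟨ sumℤ-map-filter inS? gap (allPairs n) ⟩
  sumℤ (map (λ p → 𝟙 (inS? p) * gap p) (allPairs n))
    ≡⟨ sumℤ-map-allPairs (λ p → 𝟙 (inS? p) * gap p) ⟩
  ∑[ x < n ] ∑[ y < n ] (𝟙 (inS? (x , y)) * gap (x , y))
    ≡⟨ sum-cong-≗ (λ x → sum-cong-≗ (λ y → cong (_* gap (x , y))
         (𝟙-×-dec (π ⟨$⟩ˡ x <? π ⟨$⟩ˡ y) (σ ⟨$⟩ˡ y <? σ ⟨$⟩ˡ x)))) ⟩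
  ∑[ x < n ] ∑[ y < n ] (𝟙S π σ x y * (pos π y - pos π x)) ∎
  where
  inS? : Decidable (λ (p : Fin n × Fin n) →
                     π ⟨$⟩ˡ proj₁ p < π ⟨$⟩ˡ proj₂ p × σ ⟨$⟩ˡ proj₂ p < σ ⟨$⟩ˡ proj₁ p)
  inS? p = ((π ⟨$⟩ˡ proj₁ p) <? (π ⟨$⟩ˡ proj₂ p)) ×-dec ((σ ⟨$⟩ˡ proj₂ p) <? (σ ⟨$⟩ˡ proj₁ p))
  gap : Fin n × Fin n → ℤ
  gap p = pos π (proj₂ p) - pos π (proj₁ p)

claim4p7 : (n : ℕ) (π σ : Permutation′ n) →
    + 2 * lhsSum π σ ≡ sqDist π σ
claim4p7 n π σ = begin
  + 2 * lhsSum π σ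
    ≡⟨ cong (+ 2 *_) (lhsSum≡∑𝟙S π σ) ⟩
  + 2 * ∑[ x < n ] ∑[ y < n ] (𝟙S π σ x y * (pos π y - pos π x))
    ≡⟨ cong (+ 2 *_) (∑-flow (𝟙S π σ) (pos π)) ⟩
  + 2 * ∑[ x < n ] (pos π x * ∑[ y < n ] (𝟙S π σ y x - 𝟙S π σ x y))
    ≡⟨ cong (+ 2 *_) (sum-cong-≗ (λ x → cong (pos π x *_) (pos-sub≡∑𝟙S π σ x))) ⟨
  + 2 * ∑[ x < n ] (pos π x * (pos π x - pos σ x))
    ≡⟨ ∑-polarization (pos π) (pos σ) (trans (∑-permuteˡ square π) (sym (∑-permuteˡ square σ))) ⟩
  ∑[ x < n ] ((pos π x - pos σ x) * (pos π x - pos σ x))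
    ≡⟨ sumℤ-map-allFin (λ x → (pos π x - pos σ x) * (pos π x - pos σ x)) ⟨
  sqDist π σ ∎
  where
  square : Fin n → ℤ
  square j = + toℕ j * + toℕ j
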